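{- Let $n$ be a positive integer, let $k=\lfloor n/3\rfloor$, and let $r\in\{0,1,2,3\}$ with $n\equiv r\pmod 4$. Let $$\mathcal{I}:=\Big[\,2n^2-n+66,\; k^2+\tfrac{(k-1)k(2k-1)}{3}-66\,\Big].$$ Then $\mathcal{I}\cap \mathrm{Set}_{\mathbb{Z}}(n)$ is an arithmetic progression of the form $\{4t+r\}$, i.e. it consists of the integers in $\mathcal{I}$ that are congruent to $r$ modulo $4$. Moreover, the set $$\mathcal{J}:=\mathrm{Set}_{\mathbb{Z}}(n)\cap\Big(k^2+\tfrac{(k-1)k(2k-1)}{3},\; \tfrac{n(n+1)(2n+1)}{3}\Big]$$ contains $\Omega(n^2)$ elements (i.e. at least $cn^2$ elements for some absolute constant $c>0$, for all sufficiently large $n$).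
   Context: For a finite set $A\subseteq\mathbb{Z}$, the additive energy is $E(A):=|\{(a_1,a_2,a_3,a_4)\in A^4:\ a_1+a_2=a_3+a_4\}|$. For a positive integer $n$, $\mathrm{Set}_{\mathbb{Z}}(n):=\{E(A):\ A\subseteq\mathbb{Z},\ |A|=n\}$. -}

module Defs where

open import Data.Nat using (ℕ; zero; suc; _+_; _*_; _∸_; _≤_; _<_)
open import Data.Nat.DivMod using (_/_)
open import Data.Integer as ℤ using (ℤ)
open import Data.List using (List; []; _∷_; length)
open import Data.List.Relation.Unary.Unique.Propositional using (Unique)
open import Data.Product using (∃; _×_)
open import Relation.Binary.PropositionalEquality using (_≡_)
open import Relation.Nullary using (yes; no)

countSum : ℤ → ℤ → List ℤ → ℕ
countSum s x [] = 0
countSum s x (d ∷ A) with s ℤ.≟ x ℤ.+ d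
... | yes _ = suc (countSum s x A)
... | no  _ = countSum s x A

sumOver : List ℤ → (ℤ → ℕ) → ℕ
sumOver [] f = 0
sumOver (a ∷ A) f = f a + sumOver A f

-- additive energy: number of (a1,a2,a3,a4) ∈ A^4 with a1 + a2 = a3 + a4
-- (A is a duplicate-free list representing a finite subset of ℤ)
energy : List ℤ → ℕ
energy A = sumOver A λ a₁ → sumOver A λ a₂ → sumOver A λ a₃ →
  countSum (a₁ ℤ.+ a₂) a₃ A

InSet : ℕ → ℕ → Set
InSet n m = ∃ λ (A : List ℤ) → Unique A × length A ≡ n × energy A ≡ m

-- k² + (k-1)k(2k-1)/3 with k = ⌊n/3⌋   (exact division; for k = 0 it is 0)
lowBound : ℕ → ℕ
lowBound n = let k = n / 3 in k * k + ((k ∸ 1) * k * (2 * k ∸ 1)) / 3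

topBound : ℕ → ℕ
topBound n = (n * (n + 1) * (2 * n + 1)) / 3

module Submission where

-- Adjoining a new point x to a set A of integers adds 4|A| + 1 + 4N₁ + 2N₂ to E(A), where N₂, the
-- number of ordered representations of 2x as a sum of two elements of A, is even because x ∉ A.
-- Hence E(A) ≡ |A| (mod 4), i.e. E(A) = 2|A|² − |A| + 4u for some u.
--
-- Conversely, the interval [1, j] has u = C(j,3), adjoining the point j + 1 + p to it adds
-- C(j − p, 2), and placing sets on well separated scales (X ∪ M·Y with X ⊆ [1, M/2)) adds their
-- values of u. Every u < C(k,3), k = ⌊n/3⌋, is C(j,3) + C(i,2) + 4q + s with i < j < k and
-- 4q + s < i, which is realised with n points by an extended interval, copies of [1,4] and [1,3]
-- (u = 4 and 1) and singletons. For the second part, the k² values C(j,3) + C(i,2) with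
-- k < j ≤ 2k and 1 ≤ i ≤ k are distinct and give energies between the two bounds.

open import Defs
open import Algebra.Bundles using (AbelianGroup)
open import Data.Nat
  using (ℕ; zero; suc; _+_; _*_; _∸_; _≤_; _<_; _>_; s≤s; z≤n; z<s; NonZero; >-nonZero⁻¹; _≟_; _≤?_; _<?_)
open import Data.Nat.Combinatorics using (_C_; nC1≡n; nCk+nC[k+1]≡[n+1]C[k+1])
open import Data.Nat.Properties
open import Data.Nat.DivMod using (_/_; _%_; m≡m%n+[m/n]*n; [m+kn]%n≡m%n; m<n⇒m%n≡m; m%n<n; m*n/n≡m; /-monoˡ-≤)
open import Data.Nat.Tactic.RingSolver using (solve-∀)
open import Data.Integer as ℤ using (ℤ)
import Data.Integer.Properties as ℤ
open import Data.List using (List; []; _∷_; length; map; _++_)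
open import Data.List.Membership.Propositional using (_∈_)
open import Data.List.Relation.Unary.Any using (here; there)
open import Data.List.Relation.Unary.All as All using (All; []; _∷_)
open import Data.List.Relation.Unary.AllPairs as AllPairs using (AllPairs; []; _∷_)
import Data.List.Relation.Unary.AllPairs.Properties as AllPairs
open import Data.List.Relation.Unary.Unique.Propositional using (Unique)
import Data.List.Relation.Unary.Unique.Propositional.Properties as Unique
import Data.List.Relation.Unary.All.Properties as All
open import Data.List.Properties using (length-++; length-map)
open import Data.List.Membership.Propositional.Properties using (∈-map⁻; ∈-++⁻)
open import Data.Product using (∃; _×_; _,_; proj₁; proj₂; map₁; map₂)
open import Data.Sum using (inj₁; inj₂)
open import Function using (_∘_)
open import Function.Bundles using (_⇔_; mk⇔)
open import Relation.Binary.Definitions using (DecidableEquality)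
open import Relation.Binary.PropositionalEquality
open import Relation.Nullary using (Dec; yes; no; ¬_; contradiction)
open import Relation.Nullary.Decidable using (toWitnessFalse)

open import Algebra.Properties.CommutativeSemigroup +-commutativeSemigroup using (interchange)

variable
  T U : Set

∑ : List U → (U → ℕ) → ℕ
∑ [] f = 0
∑ (a ∷ A) f = f a + ∑ A f

syntax ∑ A (λ a → e) = ∑[ a ∈ A ] e

∑² : List U → (U → U → ℕ) → ℕ
∑² A F = ∑[ a ∈ A ] ∑[ b ∈ A ] F a b

∑-cong : ∀ (A : List U) {f g : U → ℕ} → (∀ a → a ∈ A → f a ≡ g a) → ∑ A f ≡ ∑ A g
∑-cong [] _ = refl
∑-cong (a ∷ A) f≗g = cong₂ _+_ (f≗g a (here refl)) (∑-cong A (λ b → f≗g b ∘ there))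

∑-zero : ∀ (A : List U) {f : U → ℕ} → (∀ a → a ∈ A → f a ≡ 0) → ∑ A f ≡ 0
∑-zero A f≗0 = trans (∑-cong A f≗0) (zeros A)
  where
  zeros : ∀ (A : List U) → ∑[ _ ∈ A ] 0 ≡ 0
  zeros [] = refl
  zeros (_ ∷ A) = zeros A

∑-const : ∀ (A : List U) k → ∑[ _ ∈ A ] k ≡ k * length A
∑-const [] k = sym (*-zeroʳ k)
∑-const (_ ∷ A) k = trans (cong (k +_) (∑-const A k)) (sym (*-suc k (length A)))

∑-+ : ∀ (A : List U) (f g : U → ℕ) → ∑[ a ∈ A ] (f a + g a) ≡ ∑ A f + ∑ A g
∑-+ [] f g = refl
∑-+ (a ∷ A) f g = trans (cong (f a + g a +_) (∑-+ A f g)) (interchange (f a) (g a) (∑ A f) (∑ A g))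

∑-*ˡ : ∀ (A : List U) k (f : U → ℕ) → ∑[ a ∈ A ] (k * f a) ≡ k * ∑ A f
∑-*ˡ [] k f = sym (*-zeroʳ k)
∑-*ˡ (a ∷ A) k f = trans (cong (k * f a +_) (∑-*ˡ A k f)) (sym (*-distribˡ-+ k (f a) (∑ A f)))

∑-++ : ∀ (A A′ : List U) (f : U → ℕ) → ∑ (A ++ A′) f ≡ ∑ A f + ∑ A′ f
∑-++ [] A′ f = refl
∑-++ (a ∷ A) A′ f = trans (cong (f a +_) (∑-++ A A′ f)) (sym (+-assoc (f a) (∑ A f) (∑ A′ f)))

∑-map : ∀ (g : T → U) (A : List T) (f : U → ℕ) → ∑ (map g A) f ≡ ∑[ a ∈ A ] f (g a)
∑-map g [] f = refl
∑-map g (a ∷ A) f = cong (f (g a) +_) (∑-map g A f)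

∑-comm : ∀ (A : List T) (A′ : List U) (F : T → U → ℕ) →
         ∑[ a ∈ A ] ∑[ b ∈ A′ ] F a b ≡ ∑[ b ∈ A′ ] ∑[ a ∈ A ] F a b
∑-comm [] A′ F = sym (∑-zero A′ (λ _ _ → refl))
∑-comm (a ∷ A) A′ F =
  trans (cong (∑ A′ (F a) +_) (∑-comm A A′ F)) (sym (∑-+ A′ (F a) (λ b → ∑[ a′ ∈ A ] F a′ b)))

∑²-cong : ∀ (A : List U) {F G : U → U → ℕ} → (∀ a b → a ∈ A → b ∈ A → F a b ≡ G a b) → ∑² A F ≡ ∑² A G
∑²-cong A F≗G = ∑-cong A (λ a a∈ → ∑-cong A (λ b b∈ → F≗G a b a∈ b∈))

∑²-+ : ∀ (A : List U) (F G : U → U → ℕ) → ∑² A (λ a b → F a b + G a b) ≡ ∑² A F + ∑² A G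
∑²-+ A F G = trans (∑-cong A (λ a _ → ∑-+ A (F a) (G a))) (∑-+ A _ _)

∑²-*ˡ : ∀ (A : List U) k (F : U → U → ℕ) → ∑² A (λ a b → k * F a b) ≡ k * ∑² A F
∑²-*ˡ A k F = trans (∑-cong A (λ a _ → ∑-*ˡ A k (F a))) (∑-*ˡ A k _)

cong₃ : ∀ {a b c a′ b′ c′ : ℕ} (f : ℕ → ℕ → ℕ → ℕ) →
        a ≡ a′ → b ≡ b′ → c ≡ c′ → f a b c ≡ f a′ b′ c′
cong₃ f refl refl refl = refl

Symmetric : (U → U → ℕ) → Set _
Symmetric F = ∀ a b → F a b ≡ F b a

∑²-++ : ∀ (A A′ : List U) (F : U → U → ℕ) → Symmetric F →
        ∑² (A ++ A′) F ≡ ∑² A F + 2 * (∑[ a ∈ A ] ∑[ b ∈ A′ ] F a b) + ∑² A′ F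
∑²-++ A A′ F F-sym = begin
  ∑² (A ++ A′) F
    ≡⟨ ∑-cong (A ++ A′) (λ a _ → ∑-++ A A′ (F a)) ⟩
  ∑[ a ∈ A ++ A′ ] (∑ A (F a) + ∑ A′ (F a))
    ≡⟨ trans (∑-++ A A′ _) (cong₂ _+_ (∑-+ A _ _) (∑-+ A′ _ _)) ⟩
  (∑² A F + ∑[ a ∈ A ] ∑ A′ (F a)) + (∑[ b ∈ A′ ] ∑ A (F b) + ∑² A′ F)
    ≡⟨ cong (λ z → (∑² A F + ∑[ a ∈ A ] ∑ A′ (F a)) + (z + ∑² A′ F)) cross-sym ⟩
  (∑² A F + ∑[ a ∈ A ] ∑ A′ (F a)) + (∑[ a ∈ A ] ∑ A′ (F a) + ∑² A′ F)
    ≡⟨ regroup (∑² A F) _ (∑² A′ F) ⟩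
  ∑² A F + 2 * (∑[ a ∈ A ] ∑ A′ (F a)) + ∑² A′ F ∎
  where
  open ≡-Reasoning
  cross-sym : ∑[ b ∈ A′ ] ∑ A (F b) ≡ ∑[ a ∈ A ] ∑ A′ (F a)
  cross-sym = trans (∑-comm A′ A F) (∑-cong A (λ a _ → ∑-cong A′ (λ b _ → F-sym b a)))
  regroup : ∀ x y z → (x + y) + (y + z) ≡ x + 2 * y + z
  regroup = solve-∀

∑²-∷ : ∀ x (A : List U) (F : U → U → ℕ) → Symmetric F →
       ∑² (x ∷ A) F ≡ F x x + 2 * ∑ A (F x) + ∑² A F
∑²-∷ x A F F-sym = trans (∑²-++ (x ∷ []) A F F-sym)
  (cong₂ (λ d c → d + 2 * c + ∑² A F) (trans (+-identityʳ _) (+-identityʳ (F x x))) (+-identityʳ (∑ A (F x))))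

∑²-even : ∀ (A : List U) (F : U → U → ℕ) → Symmetric F → (∀ a → a ∈ A → F a a ≡ 0) →
          ∃ λ h → ∑² A F ≡ 2 * h
∑²-even [] F F-sym diag≡0 = 0 , refl
∑²-even (a ∷ A) F F-sym diag≡0 with ∑²-even A F F-sym (λ b → diag≡0 b ∘ there)
... | h , ∑²≡2h = ∑ A (F a) + h , (begin
  ∑² (a ∷ A) F                      ≡⟨ ∑²-∷ a A F F-sym ⟩
  F a a + 2 * ∑ A (F a) + ∑² A F    ≡⟨ cong₂ (λ d e → d + 2 * ∑ A (F a) + e) (diag≡0 a (here refl)) ∑²≡2h ⟩
  2 * ∑ A (F a) + 2 * h             ≡⟨ *-distribˡ-+ 2 (∑ A (F a)) h ⟨
  2 * (∑ A (F a) + h)               ∎)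
  where open ≡-Reasoning

𝟙 : {P : Set} → Dec P → ℕ
𝟙 (yes _) = 1
𝟙 (no _)  = 0

𝟙-yes : {P : Set} → P → (d : Dec P) → 𝟙 d ≡ 1
𝟙-yes p (yes _) = refl
𝟙-yes p (no ¬p) = contradiction p ¬p

𝟙-no : {P : Set} → ¬ P → (d : Dec P) → 𝟙 d ≡ 0
𝟙-no ¬p (yes p) = contradiction p ¬p
𝟙-no ¬p (no _)  = refl

𝟙-⇔ : {P Q : Set} → (P → Q) → (Q → P) → (p : Dec P) (q : Dec Q) → 𝟙 p ≡ 𝟙 q
𝟙-⇔ to from (yes p) q = sym (𝟙-yes (to p) q)
𝟙-⇔ to from (no ¬p) q = sym (𝟙-no (¬p ∘ from) q)

-- Additive energy

module AdditiveEnergy {U : Set} (_⊕_ : U → U → U) (_≟_ : DecidableEquality U) where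

  δ : U → U → ℕ
  δ a b = 𝟙 (a ≟ b)

  r : List U → U → ℕ
  r A s = ∑² A (λ b c → δ s (b ⊕ c))

  E : List U → ℕ
  E A = ∑² A (λ a b → r A (a ⊕ b))

  δ-refl : ∀ a → δ a a ≡ 1
  δ-refl a = 𝟙-yes refl (a ≟ a)

  δ-≢ : ∀ {a b} → ¬ a ≡ b → δ a b ≡ 0
  δ-≢ {a} {b} a≢b = 𝟙-no a≢b (a ≟ b)

  δ-sym : ∀ a b → δ a b ≡ δ b a
  δ-sym a b = 𝟙-⇔ sym sym (a ≟ b) (b ≟ a)

  ∑-δ : ∀ {A : List U} {a} → Unique A → a ∈ A → ∑[ b ∈ A ] δ a b ≡ 1
  ∑-δ {_ ∷ A} {a} (a∉A ∷ _) (here refl) =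
    cong₂ _+_ (δ-refl a) (∑-zero A (λ b b∈A → δ-≢ (All.lookup a∉A b∈A)))
  ∑-δ {b ∷ A} (b∉A ∷ A-unique) (there a∈A) =
    cong₂ _+_ (δ-≢ (All.lookup b∉A a∈A ∘ sym)) (∑-δ A-unique a∈A)

  r-zero : ∀ A s → (∀ b c → b ∈ A → c ∈ A → ¬ s ≡ b ⊕ c) → r A s ≡ 0
  r-zero A s s≢b⊕c = ∑-zero A (λ b b∈A → ∑-zero A (λ c c∈A → δ-≢ (s≢b⊕c b c b∈A c∈A)))

  N₁ : U → List U → ℕ
  N₁ x A = ∑[ a ∈ A ] r A (x ⊕ a)

  N₂ : U → List U → ℕ
  N₂ x A = r A (x ⊕ x)

  module Cancellative
    (⊕-comm : ∀ a b → a ⊕ b ≡ b ⊕ a)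
    (⊕-cancelˡ : ∀ a b c → a ⊕ b ≡ a ⊕ c → b ≡ c) where

    δ-cancelˡ : ∀ x a c → δ (x ⊕ a) (x ⊕ c) ≡ δ a c
    δ-cancelˡ x a c = 𝟙-⇔ (⊕-cancelˡ x a c) (cong (x ⊕_)) ((x ⊕ a) ≟ (x ⊕ c)) (a ≟ c)

    r-∷ : ∀ x A s → r (x ∷ A) s ≡ δ s (x ⊕ x) + 2 * ∑[ c ∈ A ] δ s (x ⊕ c) + r A s
    r-∷ x A s = ∑²-∷ x A (λ b c → δ s (b ⊕ c)) (λ b c → cong (δ s) (⊕-comm b c))

    E-∷ : ∀ x A → Unique (x ∷ A) → E (x ∷ A) ≡ E A + 4 * N₁ x A + 2 * N₂ x A + 4 * length A + 1
    E-∷ x A x∷A-unique@(x∉A ∷ A-unique) = begin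
      E (x ∷ A)
        ≡⟨ ∑²-∷ x A (λ a b → r (x ∷ A) (a ⊕ b)) (λ a b → cong (r (x ∷ A)) (⊕-comm a b)) ⟩
      r (x ∷ A) (x ⊕ x) + 2 * ∑[ a ∈ A ] r (x ∷ A) (x ⊕ a) + ∑² A (λ a b → r (x ∷ A) (a ⊕ b))
        ≡⟨ cong₃ (λ d c e → d + 2 * c + e) diagonal cross rest ⟩
      (1 + N₂ x A) + 2 * (2 * length A + N₁ x A) + (N₂ x A + 2 * N₁ x A + E A)
        ≡⟨ regroup (N₂ x A) (length A) (N₁ x A) (E A) ⟩
      E A + 4 * N₁ x A + 2 * N₂ x A + 4 * length A + 1 ∎
      where
      open ≡-Reasoning
      regroup : ∀ n₂ l n₁ e → (1 + n₂) + 2 * (2 * l + n₁) + (n₂ + 2 * n₁ + e) ≡ e + 4 * n₁ + 2 * n₂ + 4 * l + 1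
      regroup = solve-∀
      x⊕x-unique : ∑[ c ∈ A ] δ (x ⊕ x) (x ⊕ c) ≡ 0
      x⊕x-unique = ∑-zero A (λ c c∈A → trans (δ-cancelˡ x x c) (δ-≢ (All.lookup x∉A c∈A)))
      diagonal : r (x ∷ A) (x ⊕ x) ≡ 1 + N₂ x A
      diagonal = trans (r-∷ x A (x ⊕ x)) (cong₂ (λ d c → d + 2 * c + N₂ x A) (δ-refl (x ⊕ x)) x⊕x-unique)
      cross : ∑[ a ∈ A ] r (x ∷ A) (x ⊕ a) ≡ 2 * length A + N₁ x A
      cross = begin
        ∑[ a ∈ A ] r (x ∷ A) (x ⊕ a)
          ≡⟨ ∑-cong A (λ a a∈A → trans (r-∷ x A (x ⊕ a)) (cong₂ (λ d c → d + 2 * c + r A (x ⊕ a))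
               (trans (δ-cancelˡ x a x) (δ-≢ (All.lookup x∉A a∈A ∘ sym)))
               (trans (∑-cong A (λ c _ → δ-cancelˡ x a c)) (∑-δ A-unique a∈A)))) ⟩
        ∑[ a ∈ A ] (2 + r A (x ⊕ a))
          ≡⟨ trans (∑-+ A (λ _ → 2) (λ a → r A (x ⊕ a))) (cong (_+ N₁ x A) (∑-const A 2)) ⟩
        2 * length A + N₁ x A ∎
      rest : ∑² A (λ a b → r (x ∷ A) (a ⊕ b)) ≡ N₂ x A + 2 * N₁ x A + E A
      rest = begin
        ∑² A (λ a b → r (x ∷ A) (a ⊕ b))
          ≡⟨ ∑²-cong A (λ a b _ _ → r-∷ x A (a ⊕ b)) ⟩
        ∑² A (λ a b → δ (a ⊕ b) (x ⊕ x) + 2 * P a b + r A (a ⊕ b))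
          ≡⟨ trans (∑²-+ A (λ a b → δ (a ⊕ b) (x ⊕ x) + 2 * P a b) (λ a b → r A (a ⊕ b)))
                   (cong (_+ E A) (trans (∑²-+ A (λ a b → δ (a ⊕ b) (x ⊕ x)) (λ a b → 2 * P a b))
                                         (cong (∑² A (λ a b → δ (a ⊕ b) (x ⊕ x)) +_) (∑²-*ˡ A 2 P)))) ⟩
        ∑² A (λ a b → δ (a ⊕ b) (x ⊕ x)) + 2 * ∑² A P + E A
          ≡⟨ cong₂ (λ d c → d + 2 * c + E A) (∑²-cong A (λ a b _ _ → δ-sym (a ⊕ b) (x ⊕ x))) triple ⟩
        N₂ x A + 2 * N₁ x A + E A ∎
        where
        P : U → U → ℕ
        P a b = ∑[ c ∈ A ] δ (a ⊕ b) (x ⊕ c)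
        triple : ∑² A P ≡ N₁ x A
        triple = begin
          ∑[ a ∈ A ] ∑[ b ∈ A ] ∑[ c ∈ A ] δ (a ⊕ b) (x ⊕ c)
            ≡⟨ ∑-cong A (λ a _ → ∑-comm A A (λ b c → δ (a ⊕ b) (x ⊕ c))) ⟩
          ∑[ a ∈ A ] ∑[ c ∈ A ] ∑[ b ∈ A ] δ (a ⊕ b) (x ⊕ c)
            ≡⟨ ∑-comm A A (λ a c → ∑[ b ∈ A ] δ (a ⊕ b) (x ⊕ c)) ⟩
          ∑[ c ∈ A ] ∑[ a ∈ A ] ∑[ b ∈ A ] δ (a ⊕ b) (x ⊕ c)
            ≡⟨ ∑-cong A (λ c _ → ∑²-cong A (λ a b _ _ → δ-sym (a ⊕ b) (x ⊕ c))) ⟩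
          N₁ x A ∎

    module Parity (double-injective : ∀ a b → a ⊕ a ≡ b ⊕ b → a ≡ b) where

      N₂-even : ∀ x A → All (λ a → ¬ x ≡ a) A → ∃ λ h → N₂ x A ≡ 2 * h
      N₂-even x A x∉A = ∑²-even A (λ b c → δ (x ⊕ x) (b ⊕ c)) (λ b c → cong (δ (x ⊕ x)) (⊕-comm b c))
        (λ b b∈A → δ-≢ (All.lookup x∉A b∈A ∘ double-injective x b))

      E≡length-mod-4 : ∀ A → Unique A → ∃ λ K → E A ≡ length A + 4 * K
      E≡length-mod-4 [] _ = 0 , refl
      E≡length-mod-4 (x ∷ A) x∷A-unique@(x∉A ∷ A-unique)
        with E≡length-mod-4 A A-unique | N₂-even x A x∉A
      ... | K , E≡ | h , N₂≡ = K + N₁ x A + h + length A , (begin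
        E (x ∷ A)                                                  ≡⟨ E-∷ x A x∷A-unique ⟩
        E A + 4 * N₁ x A + 2 * N₂ x A + 4 * length A + 1
          ≡⟨ cong₂ (λ e n₂ → e + 4 * N₁ x A + 2 * n₂ + 4 * length A + 1) E≡ N₂≡ ⟩
        length A + 4 * K + 4 * N₁ x A + 2 * (2 * h) + 4 * length A + 1
          ≡⟨ regroup (length A) K (N₁ x A) h ⟩
        suc (length A) + 4 * (K + N₁ x A + h + length A) ∎)
        where
        open ≡-Reasoning
        regroup : ∀ l k n h → l + 4 * k + 4 * n + 2 * (2 * h) + 4 * l + 1 ≡ suc l + 4 * (k + n + h + l)
        regroup = solve-∀

module EnergyMap {T U : Set}
  (_⊞_ : T → T → T) (_≟ᵀ_ : DecidableEquality T) (_⊕_ : U → U → U) (_≟ᵁ_ : DecidableEquality U)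
  (g : T → U) (g-injective : ∀ {a b} → g a ≡ g b → a ≡ b) (g-homo : ∀ a b → g (a ⊞ b) ≡ g a ⊕ g b) where

  private
    module Eᵀ = AdditiveEnergy _⊞_ _≟ᵀ_
    module Eᵁ = AdditiveEnergy _⊕_ _≟ᵁ_

  δ-map : ∀ a b → Eᵁ.δ (g a) (g b) ≡ Eᵀ.δ a b
  δ-map a b = 𝟙-⇔ g-injective (cong g) (g a ≟ᵁ g b) (a ≟ᵀ b)

  r-map : ∀ A s → Eᵁ.r (map g A) (g s) ≡ Eᵀ.r A s
  r-map A s = trans (∑-map g A _) (∑-cong A (λ b _ → trans (∑-map g A _) (∑-cong A (λ c _ →
    trans (cong (Eᵁ.δ (g s)) (sym (g-homo b c))) (δ-map s (b ⊞ c))))))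

  E-map : ∀ A → Eᵁ.E (map g A) ≡ Eᵀ.E A
  E-map A = trans (∑-map g A _) (∑-cong A (λ a _ → trans (∑-map g A _) (∑-cong A (λ b _ →
    trans (cong (Eᵁ.r (map g A)) (sym (g-homo a b))) (r-map A (a ⊞ b))))))

module ℤᴱ where
  open import Algebra.Properties.Group (AbelianGroup.group ℤ.+-0-abelianGroup) using (∙-cancelˡ)
  open import Data.Integer.Tactic.RingSolver using () renaming (solve-∀ to ℤ-solve-∀)

  open AdditiveEnergy ℤ._+_ ℤ._≟_ public

  double-injective : ∀ a b → a ℤ.+ a ≡ b ℤ.+ b → a ≡ b
  double-injective a b a+a≡b+b = ℤ.*-cancelˡ-≡ (ℤ.+ 2) a b (trans (sym (twice a)) (trans a+a≡b+b (twice b)))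
    where
    twice : ∀ a → a ℤ.+ a ≡ ℤ.+ 2 ℤ.* a
    twice = ℤ-solve-∀

  open Cancellative ℤ.+-comm ∙-cancelˡ public
  open Parity double-injective public

sumOver≡∑ : ∀ A f → sumOver A f ≡ ∑ A f
sumOver≡∑ [] f = refl
sumOver≡∑ (a ∷ A) f = cong (f a +_) (sumOver≡∑ A f)

countSum≡∑δ : ∀ s x A → countSum s x A ≡ ∑[ d ∈ A ] ℤᴱ.δ s (x ℤ.+ d)
countSum≡∑δ s x [] = refl
countSum≡∑δ s x (d ∷ A) with s ℤ.≟ x ℤ.+ d
... | yes _ = cong suc (countSum≡∑δ s x A)
... | no _  = countSum≡∑δ s x A

energy≡E : ∀ A → energy A ≡ ℤᴱ.E A
energy≡E A = trans (sumOver≡∑ A _) (∑-cong A (λ a _ → trans (sumOver≡∑ A _) (∑-cong A (λ b _ →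
  trans (sumOver≡∑ A _) (∑-cong A (λ c _ → countSum≡∑δ (a ℤ.+ b) c A))))))

InSet⇒≡mod4 : ∀ n m → InSet n m → m % 4 ≡ n % 4
InSet⇒≡mod4 _ _ (A , A-unique , refl , refl) with ℤᴱ.E≡length-mod-4 A A-unique
... | K , E≡ = trans (cong (_% 4) (trans (energy≡E A) (trans E≡ (cong (length A +_) (*-comm 4 K)))))
                     ([m+kn]%n≡m%n (length A) K 4)

C₂-suc : ∀ n → suc n C 2 ≡ n + n C 2
C₂-suc n = trans (sym (nCk+nC[k+1]≡[n+1]C[k+1] n 1)) (cong (_+ n C 2) (nC1≡n n))

C₃-suc : ∀ n → suc n C 3 ≡ n C 3 + n C 2
C₃-suc n = trans (sym (nCk+nC[k+1]≡[n+1]C[k+1] n 2)) (+-comm (n C 2) (n C 3))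

open AdditiveEnergy _+_ _≟_
open Cancellative +-comm +-cancelˡ-≡

-- Sets of positive integers with prescribed energy

-- 2|A|² − |A| = |A| + 4·C(|A|,2) counts the trivial solutions; u is a quarter of the rest.
Excess : List ℕ → ℕ → Set
Excess A u = E A ≡ length A + 4 * (length A C 2 + u)

Excess-∷ : ∀ x A u → Unique (x ∷ A) → N₂ x A ≡ 0 → Excess A u → Excess (x ∷ A) (u + N₁ x A)
Excess-∷ x A u x∷A-unique N₂≡0 E≡ = begin
  E (x ∷ A)                                                        ≡⟨ E-∷ x A x∷A-unique ⟩
  E A + 4 * N₁ x A + 2 * N₂ x A + 4 * length A + 1
    ≡⟨ cong₂ (λ e n₂ → e + 4 * N₁ x A + 2 * n₂ + 4 * length A + 1) E≡ N₂≡0 ⟩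
  length A + 4 * (length A C 2 + u) + 4 * N₁ x A + 2 * 0 + 4 * length A + 1
    ≡⟨ regroup (length A) (length A C 2) u (N₁ x A) ⟩
  suc (length A) + 4 * ((length A + length A C 2) + (u + N₁ x A))
    ≡⟨ cong (λ c → suc (length A) + 4 * (c + (u + N₁ x A))) (C₂-suc (length A)) ⟨
  suc (length A) + 4 * (suc (length A) C 2 + (u + N₁ x A)) ∎
  where
  open ≡-Reasoning
  regroup : ∀ l c u n → l + 4 * (c + u) + 4 * n + 2 * 0 + 4 * l + 1 ≡ suc l + 4 * ((l + c) + (u + n))
  regroup = solve-∀

segment : ℕ → List ℕ
segment zero = []
segment (suc j) = suc j ∷ segment j

∈-segment⁻ : ∀ {b} j → b ∈ segment j → 1 ≤ b × b ≤ j
∈-segment⁻ (suc j) (here refl) = s≤s z≤n , ≤-refl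
∈-segment⁻ (suc j) (there b∈) = map₂ m≤n⇒m≤1+n (∈-segment⁻ j b∈)

segment-< : ∀ {x} j → j < x → All (_< x) (segment j)
segment-< zero _ = []
segment-< (suc j) j<x = j<x ∷ segment-< j (<-trans (n<1+n j) j<x)

segment-∌ : ∀ {x} j → j < x → All (λ b → ¬ x ≡ b) (segment j)
segment-∌ j j<x = All.map (λ b<x x≡b → <-irrefl (sym x≡b) b<x) (segment-< j j<x)

segment-unique : ∀ j → Unique (segment j)
segment-unique zero = []
segment-unique (suc j) = segment-∌ j (n<1+n j) ∷ segment-unique j

length-segment : ∀ j → length (segment j) ≡ j
length-segment zero = refl
length-segment (suc j) = cong suc (length-segment j)

𝟙-≤-suc : ∀ s n → 𝟙 (s ≤? suc n) ≡ δ s (suc n) + 𝟙 (s ≤? n)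
𝟙-≤-suc s n with s ≤? n
... | yes s≤n = trans (𝟙-yes (m≤n⇒m≤1+n s≤n) (s ≤? suc n))
                      (cong (_+ 1) (sym (δ-≢ (λ { refl → 1+n≰n s≤n }))))
... | no s≰n = trans (𝟙-⇔ (λ s≤1+n → ≤-antisym s≤1+n (≰⇒> s≰n)) ≤-reflexive (s ≤? suc n) (s ≟ suc n))
                     (sym (+-identityʳ (δ s (suc n))))

∑δ-segment : ∀ b s k → b < s → ∑[ c ∈ segment k ] δ s (b + c) ≡ 𝟙 (s ≤? b + k)
∑δ-segment b s zero b<s = sym (𝟙-no (<⇒≱ (subst (_< s) (sym (+-identityʳ b)) b<s)) (s ≤? b + 0))
∑δ-segment b s (suc k) b<s = begin
  δ s (b + suc k) + ∑[ c ∈ segment k ] δ s (b + c)  ≡⟨ cong₂ _+_ (cong (δ s) (+-suc b k)) (∑δ-segment b s k b<s) ⟩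
  δ s (suc (b + k)) + 𝟙 (s ≤? b + k)               ≡⟨ 𝟙-≤-suc s (b + k) ⟨
  𝟙 (s ≤? suc (b + k))                             ≡⟨ cong (λ t → 𝟙 (s ≤? t)) (+-suc b k) ⟨
  𝟙 (s ≤? b + suc k)                               ∎
  where open ≡-Reasoning

count-≤-segment : ∀ u m → 1 ≤ u → ∑[ b ∈ segment m ] 𝟙 (u ≤? b) ≡ suc m ∸ u
count-≤-segment (suc u) zero _ = sym (0∸n≡0 u)
count-≤-segment (suc u) (suc m) 1≤u with suc u ≤? suc m
... | yes u≤m = trans (cong suc (count-≤-segment (suc u) m 1≤u)) (sym (+-∸-assoc 1 (≤-pred u≤m)))
... | no u≰m = trans (count-≤-segment (suc u) m 1≤u)
                     (trans (m≤n⇒m∸n≡0 (≤-pred (m≤n⇒m≤1+n u>m))) (sym (m≤n⇒m∸n≡0 (≤-pred u>m))))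
  where
  u>m : suc u > suc m
  u>m = ≰⇒> u≰m

r-segment : ∀ j u → 1 ≤ u → r (segment j) (j + u) ≡ suc j ∸ u
r-segment j u 1≤u = trans (∑-cong (segment j) inner) (count-≤-segment u j 1≤u)
  where
  inner : ∀ b → b ∈ segment j → ∑[ c ∈ segment j ] δ (j + u) (b + c) ≡ 𝟙 (u ≤? b)
  inner b b∈ = trans (∑δ-segment b (j + u) j b<j+u)
    (𝟙-⇔ (λ j+u≤b+j → +-cancelˡ-≤ j u b (subst (j + u ≤_) (+-comm b j) j+u≤b+j))
         (λ u≤b → subst (j + u ≤_) (+-comm j b) (+-monoʳ-≤ j u≤b))
         (j + u ≤? b + j) (u ≤? b))
    where
    b<j+u : b < j + u
    b<j+u = ≤-trans (s≤s (proj₂ (∈-segment⁻ j b∈))) (subst (_≤ j + u) (+-comm j 1) (+-monoʳ-≤ j 1≤u))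

∸-suc-C₂ : ∀ c m → (c ∸ suc m) + (c ∸ suc m) C 2 ≡ (c ∸ m) C 2
∸-suc-C₂ zero zero = refl
∸-suc-C₂ zero (suc m) = refl
∸-suc-C₂ (suc c) zero = sym (C₂-suc c)
∸-suc-C₂ (suc c) (suc m) = ∸-suc-C₂ c m

∑-∸-segment : ∀ c m → ∑[ a ∈ segment m ] (c ∸ a) + (c ∸ m) C 2 ≡ c C 2
∑-∸-segment c zero = refl
∑-∸-segment c (suc m) = begin
  (c ∸ suc m) + ∑[ a ∈ segment m ] (c ∸ a) + (c ∸ suc m) C 2
    ≡⟨ regroup (c ∸ suc m) _ _ ⟩
  ∑[ a ∈ segment m ] (c ∸ a) + ((c ∸ suc m) + (c ∸ suc m) C 2)
    ≡⟨ cong (∑[ a ∈ segment m ] (c ∸ a) +_) (∸-suc-C₂ c m) ⟩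
  ∑[ a ∈ segment m ] (c ∸ a) + (c ∸ m) C 2
    ≡⟨ ∑-∸-segment c m ⟩
  c C 2 ∎
  where
  open ≡-Reasoning
  regroup : ∀ x y z → x + y + z ≡ y + (x + z)
  regroup = solve-∀

N₁-segment : ∀ p j → N₁ (suc (p + j)) (segment j) ≡ (j ∸ p) C 2
N₁-segment p j = begin
  ∑[ a ∈ segment j ] r (segment j) (suc (p + j) + a)
    ≡⟨ ∑-cong (segment j) (λ a _ → trans (cong (r (segment j)) (shift p j a)) (r-segment j (suc (p + a)) (s≤s z≤n))) ⟩
  ∑[ a ∈ segment j ] (j ∸ (p + a))
    ≡⟨ ∑-cong (segment j) (λ a _ → sym (∸-+-assoc j p a)) ⟩
  ∑[ a ∈ segment j ] ((j ∸ p) ∸ a)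
    ≡⟨ sym (+-identityʳ _) ⟩
  ∑[ a ∈ segment j ] ((j ∸ p) ∸ a) + 0 C 2
    ≡⟨ cong (λ d → ∑[ a ∈ segment j ] ((j ∸ p) ∸ a) + d C 2) (sym (m≤n⇒m∸n≡0 (m∸n≤m j p))) ⟩
  ∑[ a ∈ segment j ] ((j ∸ p) ∸ a) + ((j ∸ p) ∸ j) C 2
    ≡⟨ ∑-∸-segment (j ∸ p) j ⟩
  (j ∸ p) C 2 ∎
  where
  open ≡-Reasoning
  shift : ∀ p j a → suc (p + j) + a ≡ j + suc (p + a)
  shift = solve-∀

N₂-zero : ∀ x A → All (_< x) A → N₂ x A ≡ 0
N₂-zero x A A<x = r-zero A (x + x) (λ b c b∈A c∈A → <⇒≢ (+-mono-< (All.lookup A<x b∈A) (All.lookup A<x c∈A)) ∘ sym)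

extension-unique : ∀ p j → Unique (suc (p + j) ∷ segment j)
extension-unique p j = segment-∌ j (s≤s (m≤n+m j p)) ∷ segment-unique j

segment-excess : ∀ j → Excess (segment j) (j C 3)
extension-excess : ∀ p j → Excess (suc (p + j) ∷ segment j) (j C 3 + (j ∸ p) C 2)

segment-excess zero = refl
segment-excess (suc j) = subst (Excess (segment (suc j))) (sym (C₃-suc j)) (extension-excess 0 j)

extension-excess p j = subst (Excess (suc (p + j) ∷ segment j)) (cong (j C 3 +_) (N₁-segment p j))
  (Excess-∷ (suc (p + j)) (segment j) (j C 3) (extension-unique p j)
     (N₂-zero (suc (p + j)) (segment j) (segment-< j (s≤s (m≤n+m j p)))) (segment-excess j))

record Realizes (A : List ℕ) (u : ℕ) : Set where
  field
    unique   : Unique A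
    positive : All (1 ≤_) A
    excess   : Excess A u

remainder-unique : ∀ {M} .{{_ : NonZero M}} {a b} y z → a < M → b < M → a + y * M ≡ b + z * M → a ≡ b × y ≡ z
remainder-unique {M} {a} {b} y z a<M b<M eq =
  a≡b , *-cancelʳ-≡ y z M (+-cancelˡ-≡ a (y * M) (z * M) (trans eq (cong (_+ z * M) (sym a≡b))))
  where
  a≡b : a ≡ b
  a≡b = begin
    a                ≡⟨ m<n⇒m%n≡m a<M ⟨
    a % M            ≡⟨ [m+kn]%n≡m%n a y M ⟨
    (a + y * M) % M  ≡⟨ cong (_% M) eq ⟩
    (b + z * M) % M  ≡⟨ [m+kn]%n≡m%n b z M ⟩
    b % M            ≡⟨ m<n⇒m%n≡m b<M ⟩
    b                ∎
    where open ≡-Reasoning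

-- A sum of two elements of X ++ Y′ is below M iff both lie in X and a multiple of M iff neither
-- does, and a + y·M (a ∈ X) determines a and y; so the only solutions mixing X and Y′ are the
-- 4|X||Y| trivial ones.
module Dilation (M : ℕ) .{{_ : NonZero M}} (X Y : List ℕ) (X-unique : Unique X) (Y-unique : Unique Y)
  (X-small : All (λ a → 2 * a < M) X) (X-positive : All (1 ≤_) X) (Y-positive : All (1 ≤_) Y) where

  open EnergyMap _+_ _≟_ _+_ _≟_ (_* M) (λ {a} {b} → *-cancelʳ-≡ a b M) (λ a b → *-distribʳ-+ M a b)

  Y′ : List ℕ
  Y′ = map (_* M) Y

  <M : ∀ {a} → a ∈ X → a < M
  <M a∈X = ≤-<-trans (m≤m+n _ (_ + 0)) (All.lookup X-small a∈X)

  sum<M : ∀ {a b} → a ∈ X → b ∈ X → a + b < M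
  sum<M {a} {b} a∈X b∈X = *-cancelˡ-< 2 (a + b) M (begin-strict
    2 * (a + b)    ≡⟨ *-distribˡ-+ 2 a b ⟩
    2 * a + 2 * b  <⟨ +-mono-< (All.lookup X-small a∈X) (All.lookup X-small b∈X) ⟩
    M + M          ≡⟨ cong (M +_) (+-identityʳ M) ⟨
    2 * M          ∎)
    where open ≤-Reasoning

  M≤ : ∀ {y} → y ∈ Y → M ≤ y * M
  M≤ {y} y∈Y = subst (_≤ y * M) (*-identityˡ M) (*-monoˡ-≤ M (All.lookup Y-positive y∈Y))

  X-nonzero : ∀ {a} → a ∈ X → ¬ a ≡ 0
  X-nonzero a∈X refl = contradiction (All.lookup X-positive a∈X) λ ()

  X-not-multiple : ∀ {a} y z → a ∈ X → ¬ a + y * M ≡ z * M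
  X-not-multiple y z a∈X eq = X-nonzero a∈X (proj₁ (remainder-unique y z (<M a∈X) (>-nonZero⁻¹ M) eq))

  cross : ℕ → ℕ
  cross s = ∑[ b ∈ X ] ∑[ c ∈ Y′ ] δ s (b + c)

  r-++ : ∀ s → r (X ++ Y′) s ≡ r X s + 2 * cross s + r Y′ s
  r-++ s = ∑²-++ X Y′ (λ b c → δ s (b + c)) (λ b c → cong (δ s) (+-comm b c))

  r-X-large : ∀ s → M ≤ s → r X s ≡ 0
  r-X-large s M≤s = r-zero X s (λ b c b∈X c∈X s≡b+c → <⇒≱ (sum<M b∈X c∈X) (subst (M ≤_) s≡b+c M≤s))

  cross-zero : ∀ s → (∀ {b z} → b ∈ X → z ∈ Y → ¬ s ≡ b + z * M) → cross s ≡ 0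
  cross-zero s s≢ = ∑-zero X (λ b b∈X → trans (∑-map (_* M) Y _) (∑-zero Y (λ z z∈Y → δ-≢ (s≢ b∈X z∈Y))))

  r-Y′-zero : ∀ s → (∀ {y z} → y ∈ Y → z ∈ Y → ¬ s ≡ (y + z) * M) → r Y′ s ≡ 0
  r-Y′-zero s s≢ = trans (∑-map (_* M) Y _) (∑-zero Y (λ y y∈Y → trans (∑-map (_* M) Y _) (∑-zero Y (λ z z∈Y →
    δ-≢ (λ s≡ → s≢ y∈Y z∈Y (trans s≡ (sym (*-distribʳ-+ M y z))))))))

  r-small : ∀ {a a′} → a ∈ X → a′ ∈ X → r (X ++ Y′) (a + a′) ≡ r X (a + a′)
  r-small {a} {a′} a∈X a′∈X = begin
    r (X ++ Y′) s                    ≡⟨ r-++ s ⟩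
    r X s + 2 * cross s + r Y′ s     ≡⟨ cong₂ (λ c d → r X s + 2 * c + d) no-cross no-Y′-pair ⟩
    r X s + 0 + 0                    ≡⟨ trans (+-identityʳ _) (+-identityʳ _) ⟩
    r X s                            ∎
    where
    open ≡-Reasoning
    s : ℕ
    s = a + a′
    too-small : ∀ {t} → M ≤ t → ¬ s ≡ t
    too-small M≤t refl = <⇒≱ (sum<M a∈X a′∈X) M≤t
    no-cross : cross s ≡ 0
    no-cross = cross-zero s (λ {b} {z} _ z∈Y → too-small (≤-trans (M≤ z∈Y) (m≤n+m (z * M) b)))
    no-Y′-pair : r Y′ s ≡ 0
    no-Y′-pair = r-Y′-zero s (λ {y} {z} y∈Y _ → too-small (≤-trans (M≤ y∈Y) (*-monoˡ-≤ M (m≤m+n y z))))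

  r-mixed : ∀ {a y} → a ∈ X → y ∈ Y → r (X ++ Y′) (a + y * M) ≡ 2
  r-mixed {a} {y} a∈X y∈Y = begin
    r (X ++ Y′) s                    ≡⟨ r-++ s ⟩
    r X s + 2 * cross s + r Y′ s     ≡⟨ cong₃ (λ c d e → c + 2 * d + e) no-X-pair unique-cross no-Y′-pair ⟩
    2                                ∎
    where
    open ≡-Reasoning
    s : ℕ
    s = a + y * M
    no-X-pair : r X s ≡ 0
    no-X-pair = r-X-large s (≤-trans (M≤ y∈Y) (m≤n+m (y * M) a))
    no-Y′-pair : r Y′ s ≡ 0
    no-Y′-pair = r-Y′-zero s (λ {y′} {z} _ _ → X-not-multiple y (y′ + z) a∈X)
    matching : ∀ {b} → b ∈ X → ∑[ z ∈ Y ] δ s (b + z * M) ≡ δ a b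
    matching {b} b∈X with a ≟ b
    ... | yes refl = trans (∑-cong Y (λ z _ → trans (δ-cancelˡ a (y * M) (z * M)) (δ-map y z))) (∑-δ Y-unique y∈Y)
    ... | no a≢b = ∑-zero Y (λ z _ → δ-≢ (a≢b ∘ proj₁ ∘ remainder-unique y z (<M a∈X) (<M b∈X)))
    unique-cross : cross s ≡ 1
    unique-cross = trans (∑-cong X (λ b b∈X → trans (∑-map (_* M) Y _) (matching b∈X))) (∑-δ X-unique a∈X)

  r-large : ∀ {y y′} → y ∈ Y → y′ ∈ Y → r (X ++ Y′) (y * M + y′ * M) ≡ r Y (y + y′)
  r-large {y} {y′} y∈Y y′∈Y = begin
    r (X ++ Y′) s                    ≡⟨ r-++ s ⟩
    r X s + 2 * cross s + r Y′ s     ≡⟨ cong₂ (λ c d → c + 2 * d + r Y′ s) no-X-pair no-cross ⟩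
    r Y′ s                           ≡⟨ cong (r Y′) s≡[y+y′]M ⟩
    r Y′ ((y + y′) * M)              ≡⟨ r-map Y (y + y′) ⟩
    r Y (y + y′)                     ∎
    where
    open ≡-Reasoning
    s : ℕ
    s = y * M + y′ * M
    s≡[y+y′]M : s ≡ (y + y′) * M
    s≡[y+y′]M = sym (*-distribʳ-+ M y y′)
    no-X-pair : r X s ≡ 0
    no-X-pair = r-X-large s (≤-trans (M≤ y∈Y) (m≤m+n (y * M) (y′ * M)))
    no-cross : cross s ≡ 0
    no-cross = cross-zero s (λ {b} {z} b∈X _ s≡ → X-not-multiple z (y + y′) b∈X (trans (sym s≡) s≡[y+y′]M))

  E-dilation : E (X ++ Y′) ≡ E X + E Y + 4 * length X * length Y
  E-dilation = begin
    E (X ++ Y′)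
      ≡⟨ ∑²-++ X Y′ G (λ a b → cong (r (X ++ Y′)) (+-comm a b)) ⟩
    ∑² X G + 2 * (∑[ a ∈ X ] ∑[ c ∈ Y′ ] G a c) + ∑² Y′ G
      ≡⟨ cong₂ _+_ (cong₂ (λ e c → e + 2 * c) small-part mixed-part) large-part ⟩
    E X + 2 * (2 * length Y * length X) + E Y
      ≡⟨ regroup (E X) (E Y) (length X) (length Y) ⟩
    E X + E Y + 4 * length X * length Y ∎
    where
    open ≡-Reasoning
    G : ℕ → ℕ → ℕ
    G a b = r (X ++ Y′) (a + b)
    small-part : ∑² X G ≡ E X
    small-part = ∑²-cong X (λ a a′ a∈X a′∈X → r-small a∈X a′∈X)
    mixed-part : ∑[ a ∈ X ] ∑[ c ∈ Y′ ] G a c ≡ 2 * length Y * length X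
    mixed-part = trans (∑-cong X (λ a a∈X → trans (∑-map (_* M) Y _)
      (trans (∑-cong Y (λ y y∈Y → r-mixed a∈X y∈Y)) (∑-const Y 2)))) (∑-const X _)
    large-part : ∑² Y′ G ≡ E Y
    large-part = trans (∑-map (_* M) Y _) (∑-cong Y (λ y y∈Y → trans (∑-map (_* M) Y _)
      (∑-cong Y (λ y′ y′∈Y → r-large y∈Y y′∈Y))))
    regroup : ∀ e f x y → e + 2 * (2 * y * x) + f ≡ e + f + 4 * x * y
    regroup = solve-∀

C₂-+ : ∀ a b → (a + b) C 2 ≡ a C 2 + b C 2 + a * b
C₂-+ zero b = sym (+-identityʳ (b C 2))
C₂-+ (suc a) b = begin
  suc (a + b) C 2                       ≡⟨ C₂-suc (a + b) ⟩
  a + b + (a + b) C 2                   ≡⟨ cong (a + b +_) (C₂-+ a b) ⟩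
  a + b + (a C 2 + b C 2 + a * b)       ≡⟨ regroup a b (a C 2) (b C 2) ⟩
  (a + a C 2) + b C 2 + suc a * b       ≡⟨ cong (λ c → c + b C 2 + suc a * b) (C₂-suc a) ⟨
  suc a C 2 + b C 2 + suc a * b         ∎
  where
  open ≡-Reasoning
  regroup : ∀ a b c d → a + b + (c + d + a * b) ≡ (a + c) + d + suc a * b
  regroup = solve-∀

Realizes-dilation : ∀ M .{{_ : NonZero M}} {X Y u v} → All (λ a → 2 * a < M) X →
                    Realizes X u → Realizes Y v → Realizes (X ++ map (_* M) Y) (u + v)
Realizes-dilation M {X} {Y} {u} {v} X-small X-real Y-real = record
  { unique = Unique.++⁺ (unique X-real)
                        (Unique.map⁺ (λ {a} {b} → *-cancelʳ-≡ a b M) (unique Y-real)) disjoint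
  ; positive = All.++⁺ (positive X-real)
                       (All.map⁺ (All.tabulate (λ y∈Y → ≤-trans (>-nonZero⁻¹ M) (D.M≤ y∈Y))))
  ; excess = begin
      E (X ++ D.Y′)
        ≡⟨ D.E-dilation ⟩
      E X + E Y + 4 * length X * length Y
        ≡⟨ cong₂ (λ e f → e + f + 4 * length X * length Y) (excess X-real) (excess Y-real) ⟩
      length X + 4 * (length X C 2 + u) + (length Y + 4 * (length Y C 2 + v)) + 4 * length X * length Y
        ≡⟨ regroup (length X) (length Y) (length X C 2) (length Y C 2) u v ⟩
      (length X + length Y) + 4 * ((length X C 2 + length Y C 2 + length X * length Y) + (u + v))
        ≡⟨ cong (λ c → (length X + length Y) + 4 * (c + (u + v))) (C₂-+ (length X) (length Y)) ⟨
      (length X + length Y) + 4 * ((length X + length Y) C 2 + (u + v))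
        ≡⟨ cong (λ l → l + 4 * (l C 2 + (u + v))) length≡ ⟨
      length (X ++ D.Y′) + 4 * (length (X ++ D.Y′) C 2 + (u + v)) ∎
  }
  where
  open ≡-Reasoning
  open Realizes
  module D = Dilation M X Y (unique X-real) (unique Y-real) X-small (positive X-real) (positive Y-real)
  length≡ : length (X ++ D.Y′) ≡ length X + length Y
  length≡ = trans (length-++ X) (cong (length X +_) (length-map (_* M) Y))
  disjoint : ∀ {a} → ¬ (a ∈ X × a ∈ D.Y′)
  disjoint (a∈X , a∈Y′) with ∈-map⁻ (_* M) a∈Y′
  ... | y , y∈Y , refl = <⇒≱ (D.<M a∈X) (D.M≤ y∈Y)
  regroup : ∀ x y c d u v → x + 4 * (c + u) + (y + 4 * (d + v)) + 4 * x * y ≡ (x + y) + 4 * ((c + d + x * y) + (u + v))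
  regroup = solve-∀

Realizable : ℕ → ℕ → Set
Realizable n u = ∃ λ A → Realizes A u × length A ≡ n

segment-realizes : ∀ j → Realizes (segment j) (j C 3)
segment-realizes j = record
  { unique = segment-unique j ; positive = All.tabulate (proj₁ ∘ ∈-segment⁻ j) ; excess = segment-excess j }

extension-realizes : ∀ p j → Realizes (suc (p + j) ∷ segment j) (j C 3 + (j ∸ p) C 2)
extension-realizes p j = record
  { unique = extension-unique p j ; positive = s≤s z≤n ∷ Realizes.positive (segment-realizes j)
  ; excess = extension-excess p j }

realizable-dilation : ∀ M .{{_ : NonZero M}} {A n u v} → All (λ a → 2 * a < M) A → Realizes A u →
                      Realizable n v → Realizable (length A + n) (u + v)
realizable-dilation M {A} A-small A-real (X , X-real , refl) =
  A ++ map (_* M) X , Realizes-dilation M A-small A-real X-real ,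
  trans (length-++ A) (cong (length A +_) (length-map (_* M) X))

segment-small : ∀ {k} → k ≤ 4 → All (λ a → 2 * a < 10) (segment k)
segment-small {k} k≤4 = All.tabulate (λ a∈ → s≤s (≤-trans (*-monoʳ-≤ 2 (≤-trans (proj₂ (∈-segment⁻ k a∈)) k≤4)) (n≤1+n 8)))

stack-segment : ∀ {k n u} → k ≤ 4 → Realizable n u → Realizable (k + n) (k C 3 + u)
stack-segment {k} {n} {u} k≤4 = subst (λ l → Realizable (l + n) (k C 3 + u)) (length-segment k)
  ∘ realizable-dilation 10 (segment-small k≤4) (segment-realizes k)

extend-segment : ∀ p j {n u} → Realizable n u → Realizable (suc j + n) (j C 3 + (j ∸ p) C 2 + u)
extend-segment p j {n} {u} = subst (λ l → Realizable (l + n) (j C 3 + (j ∸ p) C 2 + u)) (cong suc (length-segment j))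
  ∘ realizable-dilation (suc (2 * suc (p + j)))
      (All.tabulate (λ a∈ → s≤s (*-monoʳ-≤ 2 (extension-≤ a∈)))) (extension-realizes p j)
  where
  extension-≤ : ∀ {a} → a ∈ suc (p + j) ∷ segment j → a ≤ suc (p + j)
  extension-≤ (here refl) = ≤-refl
  extension-≤ (there a∈) = ≤-trans (proj₂ (∈-segment⁻ j a∈)) (≤-trans (m≤n+m j p) (n≤1+n (p + j)))

-- Copies of [1,4], [1,3] and [1,1] have excesses 4, 1 and 0.
blocks : ∀ q s f → Realizable (4 * q + 3 * s + f) (4 * q + s)
blocks zero zero zero = [] , record { unique = [] ; positive = [] ; excess = refl } , refl
blocks zero zero (suc f) = stack-segment (s≤s z≤n) (blocks 0 0 f)
blocks zero (suc s) f = subst (λ n → Realizable n (suc s)) (three s f) (stack-segment (s≤s (s≤s (s≤s z≤n))) (blocks 0 s f))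
  where
  three : ∀ s f → 3 + (3 * s + f) ≡ 3 * suc s + f
  three = solve-∀
blocks (suc q) s f = subst₂ Realizable (four-n q s f) (four-u q s) (stack-segment ≤-refl (blocks q s f))
  where
  four-n : ∀ q s f → 4 + (4 * q + 3 * s + f) ≡ 4 * suc q + 3 * s + f
  four-n = solve-∀
  four-u : ∀ q s → 4 + (4 * q + s) ≡ 4 * suc q + s
  four-u = solve-∀

Realizable⇒InSet : ∀ {n u} → Realizable n u → InSet n (n + 4 * (n C 2 + u))
Realizable⇒InSet {u = u} (A , A-real , refl) =
  map ℤ.+_ A , Unique.map⁺ ℤ.+-injective (Realizes.unique A-real) , length-map ℤ.+_ A ,
  (begin
    energy (map ℤ.+_ A)   ≡⟨ energy≡E (map ℤ.+_ A) ⟩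
    ℤᴱ.E (map ℤ.+_ A)     ≡⟨ E-map A ⟩
    E A                   ≡⟨ Realizes.excess A-real ⟩
    length A + 4 * (length A C 2 + u) ∎)
  where
  open ≡-Reasoning
  open EnergyMap _+_ _≟_ ℤ._+_ ℤ._≟_ ℤ.+_ ℤ.+-injective (λ _ _ → refl)

extend-blocks : ∀ n j p q s f → suc j + (4 * q + 3 * s + f) ≡ n → Realizable n (j C 3 + (j ∸ p) C 2 + (4 * q + s))
extend-blocks n j p q s f refl = extend-segment p j (blocks q s f)

-- Decomposing an excess

step-mono : ∀ (f : ℕ → ℕ) → (∀ i → f i ≤ f (suc i)) → ∀ {m n} → m ≤ n → f m ≤ f n
step-mono f f-step {m} m≤n with m≤n⇒∃[o]m+o≡n m≤n
... | d , refl = go d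
  where
  go : ∀ d → f m ≤ f (m + d)
  go zero = ≤-reflexive (cong f (sym (+-identityʳ m)))
  go (suc d) = ≤-trans (go d) (subst (f (m + d) ≤_) (cong f (sym (+-suc m d))) (f-step (m + d)))

C₂-step : ∀ i → i C 2 ≤ suc i C 2
C₂-step i = subst (i C 2 ≤_) (sym (C₂-suc i)) (m≤n+m (i C 2) i)

C₃-step : ∀ i → i C 3 ≤ suc i C 3
C₃-step i = subst (i C 3 ≤_) (sym (C₃-suc i)) (m≤m+n (i C 3) (i C 2))

C₂-step-< : ∀ i → 1 ≤ i → i C 2 < suc i C 2
C₂-step-< (suc i) _ = subst (suc i C 2 <_) (sym (C₂-suc (suc i))) (m<n+m (suc i C 2) z<s)

C₃-step-< : ∀ i → 2 ≤ i → i C 3 < suc i C 3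
C₃-step-< (suc zero) (s≤s ())
C₃-step-< i@(suc (suc m)) _ = subst (i C 3 <_) (sym (C₃-suc i)) (m<m+n (i C 3) (subst (0 <_) (sym (C₂-suc (suc m))) z<s))

C₂-<-mono : ∀ {i i′} → 1 ≤ i → i < i′ → i C 2 < i′ C 2
C₂-<-mono {i} 1≤i i<i′ = <-≤-trans (C₂-step-< i 1≤i) (step-mono (_C 2) C₂-step i<i′)

C₃+C₂<C₃-suc : ∀ {i j} → 1 ≤ i → i < j → j C 3 + i C 2 < suc j C 3
C₃+C₂<C₃-suc {i} {j} 1≤i i<j = subst (j C 3 + i C 2 <_) (sym (C₃-suc j)) (+-monoʳ-< (j C 3) (C₂-<-mono 1≤i i<j))

bracket : ∀ (f : ℕ → ℕ) i₀ → f i₀ ≡ 0 → (∀ i → i₀ ≤ i → f i < f (suc i)) →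
          ∀ t → ∃ λ i → i₀ ≤ i × f i ≤ t × t < f (suc i)
bracket f i₀ f≡0 f-inc zero = i₀ , ≤-refl , ≤-reflexive f≡0 , subst (_< f (suc i₀)) f≡0 (f-inc i₀ ≤-refl)
bracket f i₀ f≡0 f-inc (suc t) with bracket f i₀ f≡0 f-inc t
... | i , i₀≤i , fi≤t , t<f[1+i] with suc t <? f (suc i)
...   | yes 1+t<f[1+i] = i , i₀≤i , m≤n⇒m≤1+n fi≤t , 1+t<f[1+i]
...   | no 1+t≮f[1+i] = suc i , m≤n⇒m≤1+n i₀≤i , ≤-reflexive f[1+i]≡1+t ,
                       subst (_< f (suc (suc i))) f[1+i]≡1+t (f-inc (suc i) (m≤n⇒m≤1+n i₀≤i))
  where
  f[1+i]≡1+t : f (suc i) ≡ suc t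
  f[1+i]≡1+t = ≤-antisym (≮⇒≥ 1+t≮f[1+i]) t<f[1+i]

decompose : ∀ k t → t < k C 3 → ∃ λ j → ∃ λ i → ∃ λ r → r < i × i < j × j < k × j C 3 + i C 2 + r ≡ t
decompose k t t<kC3
  with bracket (_C 3) 2 refl C₃-step-< t
... | j , _ , jC3≤t , t<[1+j]C3
  with m≤n⇒∃[o]m+o≡n jC3≤t
... | r , jC3+r≡t
  with bracket (_C 2) 1 refl C₂-step-< r
... | i , _ , iC2≤r , r<[1+i]C2
  with m≤n⇒∃[o]m+o≡n iC2≤r
... | r₁ , iC2+r₁≡r =
  j , i , r₁ , r₁<i , i<j , j<k , trans (+-assoc (j C 3) (i C 2) r₁) (trans (cong (j C 3 +_) iC2+r₁≡r) jC3+r≡t)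
  where
  r<jC2 : r < j C 2
  r<jC2 = +-cancelˡ-< (j C 3) r (j C 2) (subst₂ _<_ (sym jC3+r≡t) (C₃-suc j) t<[1+j]C3)
  r₁<i : r₁ < i
  r₁<i = +-cancelˡ-< (i C 2) r₁ i (subst₂ _<_ (sym iC2+r₁≡r) (trans (C₂-suc i) (+-comm i (i C 2))) r<[1+i]C2)
  i<j : i < j
  i<j = ≰⇒> (λ j≤i → <⇒≱ r<jC2 (≤-trans (step-mono (_C 2) C₂-step j≤i) iC2≤r))
  j<k : j < k
  j<k = ≰⇒> (λ k≤j → <⇒≱ t<kC3 (≤-trans (step-mono (_C 3) C₃-step k≤j) jC3≤t))

blocks-fit : ∀ {n k j r} → 2 + r ≤ j → j < k → 3 ≤ k → 3 * k ≤ n → suc j + (4 * (r / 4) + 3 * (r % 4)) ≤ n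
blocks-fit {n} {k} {j} {r} 2+r≤j j<k 3≤k 3k≤n = begin
  suc j + (4 * q + 3 * s)    ≡⟨ cong (suc j +_) (trans (spread q s) (cong (_+ 2 * s) (sym (m≡m%n+[m/n]*n r 4)))) ⟩
  suc j + (r + 2 * s)        ≤⟨ +-monoʳ-≤ (suc j) (+-monoʳ-≤ r (*-monoʳ-≤ 2 (≤-pred (m%n<n r 4)))) ⟩
  suc j + (r + 6)            ≡⟨ shuffle j r ⟩
  suc j + (2 + r) + 4        ≤⟨ +-monoˡ-≤ 4 (+-mono-≤ j<k 2+r≤j) ⟩
  k + j + 4                  ≡⟨ trans (+-assoc k j 4) (cong (k +_) (+-suc j 3)) ⟩
  k + (suc j + 3)            ≤⟨ +-monoʳ-≤ k (+-mono-≤ j<k 3≤k) ⟩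
  k + (k + k)                ≡⟨ triple k ⟩
  3 * k                      ≤⟨ 3k≤n ⟩
  n                          ∎
  where
  open ≤-Reasoning
  q : ℕ
  q = r / 4
  s : ℕ
  s = r % 4
  spread : ∀ q s → 4 * q + 3 * s ≡ s + q * 4 + 2 * s
  spread = solve-∀
  shuffle : ∀ j r → suc j + (r + 6) ≡ suc j + (2 + r) + 4
  shuffle = solve-∀
  triple : ∀ k → k + (k + k) ≡ 3 * k
  triple = solve-∀

realizable-below : ∀ n k t → 3 ≤ k → 3 * k ≤ n → t < k C 3 → Realizable n t
realizable-below n k t 3≤k 3k≤n t<kC3 with decompose k t t<kC3
... | j , i , r , r<i , i<j , j<k , excess≡t = subst (Realizable n) excess≡
  (extend-blocks n j (j ∸ i) (r / 4) (r % 4) (n ∸ used)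
    (trans (sym (+-assoc (suc j) _ (n ∸ used))) (m+[n∸m]≡n (blocks-fit (≤-trans (s≤s r<i) i<j) j<k 3≤k 3k≤n))))
  where
  used : ℕ
  used = suc j + (4 * (r / 4) + 3 * (r % 4))
  excess≡ : j C 3 + (j ∸ (j ∸ i)) C 2 + (4 * (r / 4) + r % 4) ≡ t
  excess≡ = begin
    j C 3 + (j ∸ (j ∸ i)) C 2 + (4 * (r / 4) + r % 4)
      ≡⟨ cong₂ (λ a b → j C 3 + a C 2 + b) (m∸[m∸n]≡n (<⇒≤ i<j))
               (trans (+-comm (4 * (r / 4)) (r % 4)) (trans (cong (r % 4 +_) (*-comm 4 (r / 4))) (sym (m≡m%n+[m/n]*n r 4)))) ⟩
    j C 3 + i C 2 + r
      ≡⟨ excess≡t ⟩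
    t ∎
    where open ≡-Reasoning

C₂-double : ∀ n → 2 * (suc n C 2) ≡ suc n * n
C₂-double zero = refl
C₂-double (suc n) = begin
  2 * (suc (suc n) C 2)          ≡⟨ cong (2 *_) (C₂-suc (suc n)) ⟩
  2 * (suc n + suc n C 2)        ≡⟨ *-distribˡ-+ 2 (suc n) (suc n C 2) ⟩
  2 * suc n + 2 * (suc n C 2)    ≡⟨ cong (2 * suc n +_) (C₂-double n) ⟩
  2 * suc n + suc n * n          ≡⟨ regroup n ⟩
  suc (suc n) * suc n            ∎
  where
  open ≡-Reasoning
  regroup : ∀ n → 2 * suc n + suc n * n ≡ suc (suc n) * suc n
  regroup = solve-∀

C₂-square : ∀ n → n + 2 * (n C 2) ≡ n * n
C₂-square zero = refl
C₂-square (suc n) = trans (cong (suc n +_) (C₂-double n)) (regroup n)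
  where
  regroup : ∀ n → suc n + suc n * n ≡ suc n * suc n
  regroup = solve-∀

C₃-sextuple : ∀ j → 6 * ((2 + j) C 3) ≡ (2 + j) * (1 + j) * j
C₃-sextuple zero = refl
C₃-sextuple (suc j) = begin
  6 * ((3 + j) C 3)                                 ≡⟨ cong (6 *_) (C₃-suc (2 + j)) ⟩
  6 * ((2 + j) C 3 + (2 + j) C 2)                   ≡⟨ regroup ((2 + j) C 3) ((2 + j) C 2) ⟩
  6 * ((2 + j) C 3) + 3 * (2 * ((2 + j) C 2))       ≡⟨ cong₂ (λ a b → a + 3 * b) (C₃-sextuple j) (C₂-double (suc j)) ⟩
  (2 + j) * (1 + j) * j + 3 * ((2 + j) * (1 + j))   ≡⟨ closed j ⟩
  (3 + j) * (2 + j) * (1 + j)                       ∎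
  where
  open ≡-Reasoning
  regroup : ∀ a b → 6 * (a + b) ≡ 6 * a + 3 * (2 * b)
  regroup = solve-∀
  closed : ∀ j → (2 + j) * (1 + j) * j + 3 * ((2 + j) * (1 + j)) ≡ (3 + j) * (2 + j) * (1 + j)
  closed = solve-∀

trivialEnergy : ℕ → ℕ
trivialEnergy n = n + 4 * (n C 2)

trivialEnergy-mono : ∀ {k n} → k ≤ n → trivialEnergy k ≤ trivialEnergy n
trivialEnergy-mono k≤n = +-mono-≤ k≤n (*-monoʳ-≤ 4 (step-mono (_C 2) C₂-step k≤n))

2n²∸n≡trivialEnergy : ∀ n → 2 * n * n ∸ n ≡ trivialEnergy n
2n²∸n≡trivialEnergy n = trans (cong (_∸ n) 2n²≡) (m+n∸n≡m (trivialEnergy n) n)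
  where
  regroup : ∀ n c → 2 * (n + 2 * c) ≡ n + 4 * c + n
  regroup = solve-∀
  2n²≡ : 2 * n * n ≡ trivialEnergy n + n
  2n²≡ = trans (*-assoc 2 n n) (trans (cong (2 *_) (sym (C₂-square n))) (regroup n (n C 2)))

lowBoundAt : ℕ → ℕ
lowBoundAt k = k * k + ((k ∸ 1) * k * (2 * k ∸ 1)) / 3

lowBoundAt≡ : ∀ k → lowBoundAt k ≡ 4 * (suc k C 3) + k
lowBoundAt≡ zero = refl
lowBoundAt≡ (suc zero) = refl
lowBoundAt≡ k@(suc (suc j)) = begin
  k * k + ((k ∸ 1) * k * (2 * k ∸ 1)) / 3   ≡⟨ cong (λ x → k * k + x / 3) numerator≡ ⟩
  k * k + (V * 3) / 3                       ≡⟨ cong (k * k +_) (m*n/n≡m V 3) ⟩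
  k * k + V                                 ≡⟨ regroup j (k C 3) ⟩
  4 * (k C 3) + 2 * (k * suc j) + k         ≡⟨ cong (λ c → 4 * (k C 3) + 2 * c + k) (C₂-double (suc j)) ⟨
  4 * (k C 3) + 2 * (2 * (k C 2)) + k       ≡⟨ cong (_+ k) (regroup′ (k C 3) (k C 2)) ⟩
  4 * (k C 3 + k C 2) + k                   ≡⟨ cong (λ c → 4 * c + k) (C₃-suc k) ⟨
  4 * (suc k C 3) + k                       ∎
  where
  open ≡-Reasoning
  V : ℕ
  V = 4 * (k C 3) + k * suc j
  regroup : ∀ j c → (2 + j) * (2 + j) + (4 * c + (2 + j) * suc j) ≡ 4 * c + 2 * ((2 + j) * suc j) + (2 + j)
  regroup = solve-∀
  regroup′ : ∀ c d → 4 * c + 2 * (2 * d) ≡ 4 * (c + d)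
  regroup′ = solve-∀
  2k∸1≡ : 2 * k ∸ 1 ≡ 3 + 2 * j
  2k∸1≡ = cong (_∸ 1) (double j)
    where
    double : ∀ j → 2 * (2 + j) ≡ 1 + (3 + 2 * j)
    double = solve-∀
  numerator≡ : (k ∸ 1) * k * (2 * k ∸ 1) ≡ V * 3
  numerator≡ = begin
    suc j * k * (2 * k ∸ 1)                    ≡⟨ cong (suc j * k *_) 2k∸1≡ ⟩
    suc j * k * (3 + 2 * j)                    ≡⟨ expand j ⟩
    2 * (k * suc j * j) + k * suc j * 3        ≡⟨ cong (λ c → 2 * c + k * suc j * 3) (C₃-sextuple j) ⟨
    2 * (6 * (k C 3)) + k * suc j * 3          ≡⟨ collect (k C 3) (k * suc j) ⟩
    V * 3                                      ∎
    where
    expand : ∀ j → suc j * (2 + j) * (3 + 2 * j) ≡ 2 * ((2 + j) * suc j * j) + (2 + j) * suc j * 3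
    expand = solve-∀
    collect : ∀ c x → 2 * (6 * c) + x * 3 ≡ (4 * c + x) * 3
    collect = solve-∀

topBound-identity : ∀ n → (n + 4 * (n C 2 + n C 3)) * 3 + 3 * (n * n) ≡ n * (n + 1) * (2 * n + 1)
topBound-identity zero = refl
topBound-identity (suc zero) = refl
topBound-identity n@(suc (suc j)) = begin
  (n + 4 * (n C 2 + n C 3)) * 3 + 3 * (n * n)
    ≡⟨ spread n (n C 2) (n C 3) ⟩
  3 * n + 6 * (2 * (n C 2)) + 2 * (6 * (n C 3)) + 3 * (n * n)
    ≡⟨ cong₂ (λ a b → 3 * n + 6 * a + 2 * b + 3 * (n * n)) (C₂-double (suc j)) (C₃-sextuple j) ⟩
  3 * n + 6 * (n * suc j) + 2 * (n * suc j * j) + 3 * (n * n)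
    ≡⟨ closed j ⟩
  n * (n + 1) * (2 * n + 1) ∎
  where
  open ≡-Reasoning
  spread : ∀ n c d → (n + 4 * (c + d)) * 3 + 3 * (n * n) ≡ 3 * n + 6 * (2 * c) + 2 * (6 * d) + 3 * (n * n)
  spread = solve-∀
  closed : ∀ j → 3 * (2 + j) + 6 * ((2 + j) * suc j) + 2 * ((2 + j) * suc j * j) + 3 * ((2 + j) * (2 + j))
               ≡ (2 + j) * ((2 + j) + 1) * (2 * (2 + j) + 1)
  closed = solve-∀

≤topBound : ∀ n → n + 4 * (n C 2 + n C 3) ≤ topBound n
≤topBound n = begin
  Y                                ≡⟨ m*n/n≡m Y 3 ⟨
  Y * 3 / 3                        ≤⟨ /-monoˡ-≤ 3 (m≤m+n (Y * 3) (3 * (n * n))) ⟩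
  (Y * 3 + 3 * (n * n)) / 3        ≡⟨ cong (_/ 3) (topBound-identity n) ⟩
  topBound n                       ∎
  where
  open ≤-Reasoning
  Y : ℕ
  Y = n + 4 * (n C 2 + n C 3)

3[n/3]≤n : ∀ n → 3 * (n / 3) ≤ n
3[n/3]≤n n = begin
  3 * (n / 3)               ≡⟨ *-comm 3 (n / 3) ⟩
  n / 3 * 3                 ≤⟨ m≤n+m (n / 3 * 3) (n % 3) ⟩
  n % 3 + n / 3 * 3         ≡⟨ m≡m%n+[m/n]*n n 3 ⟨
  n                         ∎
  where open ≤-Reasoning

%-≡⇒∸-multiple : ∀ a b d .{{_ : NonZero d}} → a % d ≡ b % d → a ∸ b ≡ (a / d ∸ b / d) * d
%-≡⇒∸-multiple a b d a%d≡b%d = begin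
  a ∸ b                                        ≡⟨ cong₂ _∸_ (m≡m%n+[m/n]*n a d) (m≡m%n+[m/n]*n b d) ⟩
  (a % d + (a / d) * d) ∸ (b % d + (b / d) * d)  ≡⟨ cong (λ x → (a % d + (a / d) * d) ∸ (x + (b / d) * d)) a%d≡b%d ⟨
  (a % d + (a / d) * d) ∸ (a % d + (b / d) * d)  ≡⟨ [m+n]∸[m+o]≡n∸o (a % d) _ _ ⟩
  (a / d) * d ∸ (b / d) * d                    ≡⟨ *-distribʳ-∸ d (a / d) (b / d) ⟨
  (a / d ∸ b / d) * d                          ∎
  where open ≡-Reasoning

66≤lowBoundAt⇒3≤k : ∀ k → 66 ≤ lowBoundAt k → 3 ≤ k
66≤lowBoundAt⇒3≤k 0 66≤ = contradiction 66≤ (toWitnessFalse {a? = 66 ≤? _} _)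
66≤lowBoundAt⇒3≤k 1 66≤ = contradiction 66≤ (toWitnessFalse {a? = 66 ≤? _} _)
66≤lowBoundAt⇒3≤k 2 66≤ = contradiction 66≤ (toWitnessFalse {a? = 66 ≤? _} _)
66≤lowBoundAt⇒3≤k (suc (suc (suc k))) _ = s≤s (s≤s (s≤s z≤n))

≡mod4⇒InSet : ∀ n m → 2 * n * n ∸ n + 66 ≤ m → m + 66 ≤ lowBound n → m % 4 ≡ n % 4 → InSet n m
≡mod4⇒InSet n m lower upper m≡n = subst (InSet n) (sym m≡) (Realizable⇒InSet (realizable-below n k t 3≤k (3[n/3]≤n n) t<kC3))
  where
  X : ℕ
  X = trivialEnergy n
  X+66≤m : X + 66 ≤ m
  X+66≤m = subst (λ x → x + 66 ≤ m) (2n²∸n≡trivialEnergy n) lower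
  X%4≡n%4 : X % 4 ≡ n % 4
  X%4≡n%4 = trans (cong (λ c → (n + c) % 4) (*-comm 4 (n C 2))) ([m+kn]%n≡m%n n (n C 2) 4)
  t : ℕ
  t = m / 4 ∸ X / 4
  m≡X+4t : m ≡ X + 4 * t
  m≡X+4t = trans (sym (m+[n∸m]≡n (≤-trans (m≤m+n X 66) X+66≤m)))
                 (cong (X +_) (trans (%-≡⇒∸-multiple m X 4 (trans m≡n (sym X%4≡n%4))) (*-comm t 4)))
  m≡ : m ≡ n + 4 * (n C 2 + t)
  m≡ = trans m≡X+4t (trans (+-assoc n _ _) (cong (n +_) (sym (*-distribˡ-+ 4 (n C 2) t))))
  k : ℕ
  k = n / 3
  3≤k : 3 ≤ k
  3≤k = 66≤lowBoundAt⇒3≤k k (≤-trans (m≤n+m 66 m) upper)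
  t<kC3 : t < k C 3
  t<kC3 = *-cancelˡ-< 4 t (k C 3) (+-cancelˡ-< X (4 * t) (4 * (k C 3)) (begin-strict
    X + 4 * t                          <⟨ m<m+n (X + 4 * t) z<s ⟩
    X + 4 * t + 66                     ≡⟨ cong (_+ 66) m≡X+4t ⟨
    m + 66                             ≤⟨ upper ⟩
    lowBoundAt k                       ≡⟨ lowBoundAt≡ k ⟩
    4 * (suc k C 3) + k                ≡⟨ cong (λ c → 4 * c + k) (C₃-suc k) ⟩
    4 * (k C 3 + k C 2) + k            ≡⟨ regroup (k C 3) (k C 2) k ⟩
    trivialEnergy k + 4 * (k C 3)      ≤⟨ +-monoˡ-≤ (4 * (k C 3)) (trivialEnergy-mono (≤-trans (m≤m+n k (k + (k + 0))) (3[n/3]≤n n))) ⟩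
    X + 4 * (k C 3)                    ∎))
    where
    open ≤-Reasoning
    regroup : ∀ c d k → 4 * (c + d) + k ≡ k + 4 * d + 4 * c
    regroup = solve-∀

-- Many energies above the lower bound

module Rows (k : ℕ) where

  row : ℕ → List ℕ
  row j = map (λ i → j C 3 + i C 2) (segment k)

  rows : ℕ → List ℕ
  rows zero = []
  rows (suc c) = row (suc c + k) ++ rows c

  ∈-row⁻ : ∀ {v} j → v ∈ row j → ∃ λ i → 1 ≤ i × i ≤ k × v ≡ j C 3 + i C 2
  ∈-row⁻ j v∈ with ∈-map⁻ (λ i → j C 3 + i C 2) v∈
  ... | i , i∈ , refl = i , proj₁ (∈-segment⁻ k i∈) , proj₂ (∈-segment⁻ k i∈) , refl

  row-bounds : ∀ {v j} → k < j → v ∈ row j → j C 3 ≤ v × v < suc j C 3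
  row-bounds {j = j} k<j v∈ with ∈-row⁻ j v∈
  ... | i , 1≤i , i≤k , refl = m≤m+n (j C 3) (i C 2) , C₃+C₂<C₃-suc 1≤i (≤-<-trans i≤k k<j)

  segment-sorted : ∀ m → AllPairs (λ a b → 1 ≤ b × b < a) (segment m)
  segment-sorted zero = []
  segment-sorted (suc m) = All.tabulate (λ b∈ → map₂ s≤s (∈-segment⁻ m b∈)) ∷ segment-sorted m

  row-sorted : ∀ j → AllPairs _>_ (row j)
  row-sorted j = AllPairs.map⁺ (AllPairs.map (λ (1≤b , b<a) → +-monoʳ-< (j C 3) (C₂-<-mono 1≤b b<a)) (segment-sorted k))

  ∈-rows⁻ : ∀ {v} c → v ∈ rows c → ∃ λ j → k < j × j ≤ c + k × v ∈ row j
  ∈-rows⁻ (suc c) v∈ with ∈-++⁻ (row (suc c + k)) v∈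
  ... | inj₁ v∈row = suc c + k , s≤s (m≤n+m k c) , ≤-refl , v∈row
  ... | inj₂ v∈rows = map₂ (map₂ (map₁ m≤n⇒m≤1+n)) (∈-rows⁻ c v∈rows)

  rows-sorted : ∀ c → AllPairs _>_ (rows c)
  rows-sorted zero = []
  rows-sorted (suc c) = AllPairs.++⁺ (row-sorted (suc c + k)) (rows-sorted c)
    (All.tabulate (λ x∈ → All.tabulate (λ y∈ → later x∈ y∈)))
    where
    later : ∀ {x y} → x ∈ row (suc c + k) → y ∈ rows c → x > y
    later x∈ y∈ with ∈-rows⁻ c y∈
    ... | j , k<j , j≤c+k , y∈row = <-≤-trans (proj₂ (row-bounds k<j y∈row))
      (≤-trans (step-mono (_C 3) C₃-step (s≤s j≤c+k)) (proj₁ (row-bounds (s≤s (m≤n+m k c)) x∈)))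

  length-rows : ∀ c → length (rows c) ≡ c * k
  length-rows zero = refl
  length-rows (suc c) = trans (length-++ (row (suc c + k)))
    (cong₂ _+_ (trans (length-map _ (segment k)) (length-segment k)) (length-rows c))

n≤3[n/3]+2 : ∀ n → n ≤ 3 * (n / 3) + 2
n≤3[n/3]+2 n = begin
  n                      ≡⟨ m≡m%n+[m/n]*n n 3 ⟩
  n % 3 + n / 3 * 3      ≤⟨ +-monoˡ-≤ (n / 3 * 3) (≤-pred (m%n<n n 3)) ⟩
  2 + n / 3 * 3          ≡⟨ trans (+-comm 2 (n / 3 * 3)) (cong (_+ 2) (*-comm (n / 3) 3)) ⟩
  3 * (n / 3) + 2        ∎
  where open ≤-Reasoning

n≤4[n/3] : ∀ n → 6 ≤ n → n ≤ 4 * (n / 3)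
n≤4[n/3] n 6≤n = ≤-trans (n≤3[n/3]+2 n) (≤-trans (+-monoʳ-≤ (3 * k) 2≤k) (≤-reflexive (split k)))
  where
  k : ℕ
  k = n / 3
  split : ∀ k → 3 * k + k ≡ 4 * k
  split = solve-∀
  2≤k : 2 ≤ k
  2≤k = ≰⇒> (λ k≤1 → <⇒≱ (s≤s (≤-trans (n≤3[n/3]+2 n) (+-monoˡ-≤ 2 (*-monoʳ-≤ 3 k≤1)))) 6≤n)

energy-window : ∀ n j i → n / 3 < j → j ≤ n / 3 + n / 3 → 1 ≤ i → i ≤ n / 3 →
  let m = n + 4 * (n C 2 + (j C 3 + i C 2)) in InSet n m × lowBound n < m × m ≤ topBound n
energy-window n j i k<j j≤2k 1≤i i≤k = in-set , above , below
  where
  k : ℕ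
  k = n / 3
  2k<3k : k + k < 3 * k
  2k<3k = subst (k + k <_) (triple k) (m<m+n (k + k) (≤-trans 1≤i i≤k))
    where
    triple : ∀ k → k + k + k ≡ 3 * k
    triple = solve-∀
  k<n : k < n
  k<n = <-≤-trans (≤-<-trans (m≤m+n k k) 2k<3k) (3[n/3]≤n n)
  1+j≤n : suc j ≤ n
  1+j≤n = ≤-trans (s≤s j≤2k) (≤-trans 2k<3k (3[n/3]≤n n))
  i<j : i < j
  i<j = ≤-<-trans i≤k k<j
  in-set : InSet n (n + 4 * (n C 2 + (j C 3 + i C 2)))
  in-set = subst (λ u → InSet n (n + 4 * (n C 2 + u))) excess≡
    (Realizable⇒InSet (extend-blocks n j (j ∸ i) 0 0 (n ∸ suc j) (m+[n∸m]≡n 1+j≤n)))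
    where
    excess≡ : j C 3 + (j ∸ (j ∸ i)) C 2 + 0 ≡ j C 3 + i C 2
    excess≡ = trans (+-identityʳ _) (cong (λ a → j C 3 + a C 2) (m∸[m∸n]≡n (<⇒≤ i<j)))
  above : lowBound n < n + 4 * (n C 2 + (j C 3 + i C 2))
  above = begin-strict
    lowBound n                                   ≡⟨ lowBoundAt≡ k ⟩
    4 * (suc k C 3) + k                          <⟨ +-mono-≤-< (*-monoʳ-≤ 4 (step-mono (_C 3) C₃-step k<j)) k<n ⟩
    4 * (j C 3) + n                              ≤⟨ m≤m+n (4 * (j C 3) + n) _ ⟩
    4 * (j C 3) + n + 4 * (n C 2 + i C 2)        ≡⟨ regroup n (n C 2) (j C 3) (i C 2) ⟩
    n + 4 * (n C 2 + (j C 3 + i C 2))            ∎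
    where
    open ≤-Reasoning
    regroup : ∀ n c d e → 4 * d + n + 4 * (c + e) ≡ n + 4 * (c + (d + e))
    regroup = solve-∀
  below : n + 4 * (n C 2 + (j C 3 + i C 2)) ≤ topBound n
  below = ≤-trans (+-monoʳ-≤ n (*-monoʳ-≤ 4 (+-monoʳ-≤ (n C 2)
            (<⇒≤ (<-≤-trans (C₃+C₂<C₃-suc 1≤i i<j) (step-mono (_C 3) C₃-step 1+j≤n))))))
          (≤topBound n)

energies-above-lowBound : ∀ n → 6 ≤ n →
  ∃ λ (L : List ℕ) → Unique L × All (λ m → InSet n m × lowBound n < m × m ≤ topBound n) L × n * n ≤ 16 * length L
energies-above-lowBound n 6≤n = map energy-of (rows k) , unique , All.map⁺ (All.tabulate in-window) , count
  where
  k : ℕ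
  k = n / 3
  open Rows k
  energy-of : ℕ → ℕ
  energy-of u = n + 4 * (n C 2 + u)
  energy-of-< : ∀ {u u′} → u < u′ → energy-of u < energy-of u′
  energy-of-< u<u′ = +-monoʳ-< n (*-monoʳ-< 4 (+-monoʳ-< (n C 2) u<u′))
  unique : Unique (map energy-of (rows k))
  unique = AllPairs.map >⇒≢ (AllPairs.map⁺ (AllPairs.map energy-of-< (rows-sorted k)))
  in-window : ∀ {v} → v ∈ rows k → InSet n (energy-of v) × lowBound n < energy-of v × energy-of v ≤ topBound n
  in-window v∈ with ∈-rows⁻ k v∈
  ... | j , k<j , j≤2k , v∈row with ∈-row⁻ j v∈row
  ...   | i , 1≤i , i≤k , refl = energy-window n j i k<j j≤2k 1≤i i≤k
  count : n * n ≤ 16 * length (map energy-of (rows k))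
  count = begin
    n * n                                  ≤⟨ *-mono-≤ (n≤4[n/3] n 6≤n) (n≤4[n/3] n 6≤n) ⟩
    (4 * k) * (4 * k)                      ≡⟨ square k ⟩
    16 * (k * k)                           ≡⟨ cong (16 *_) (trans (length-map energy-of (rows k)) (length-rows k)) ⟨
    16 * length (map energy-of (rows k))   ∎
    where
    open ≤-Reasoning
    square : ∀ k → (4 * k) * (4 * k) ≡ 16 * (k * k)
    square = solve-∀

theorem2p1 : ((n : ℕ) → .{{_ : NonZero n}} → (m : ℕ) →
                  2 * n * n ∸ n + 66 ≤ m → m + 66 ≤ lowBound n →
                  (InSet n m ⇔ (m % 4 ≡ n % 4)))
               × (∃ λ (q : ℕ) → NonZero q × ∃ λ (N : ℕ) → (n : ℕ) → N ≤ n →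
                  ∃ λ (L : List ℕ) → Unique L
                    × All (λ m → InSet n m × lowBound n < m × m ≤ topBound n) L
                    × n * n ≤ q * length L)
theorem2p1 = (λ n m lower upper → mk⇔ (InSet⇒≡mod4 n m) (≡mod4⇒InSet n m lower upper))
           , 16 , _ , 6 , energies-above-lowBound
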